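{- Let $q$ be a prime, let $a_1, a_2, a_3$ be three distinct elements of $\mathbb{Z}_q$, and let $u$ be a positive integer not divisible by $q$. Define $A = \{a_{\sigma(1)} + u a_{\sigma(2)} + u^2 a_{\sigma(3)} : \sigma \in S_3\} \subseteq \mathbb{Z}_q$. (a) If $\mathrm{ord}_q(u) > 3$, then $|A| \ge 4$. (b) If $\mathrm{ord}_q(u) = 3$, then $0 \in A$ or $|A| = 6$.
   Context: $\mathrm{ord}_q(u)$ denotes the multiplicative order of $u$ modulo $q$; $S_3$ is the symmetric group on $\{1,2,3\}$. -}

module Defs where

open import Data.Nat using (ℕ; zero; suc; _+_; _*_; _^_; _<_; NonZero)
open import Data.Nat.DivMod using (_%_)
open import Data.Nat.Properties using (_≟_)
open import Data.Fin using (Fin; zero; suc)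
open import Data.List using (List; []; _∷_; map; length; deduplicate)
open import Data.Product using (_×_)
open import Relation.Binary.PropositionalEquality using (_≡_; _≢_)

-- Elements of ℤ_q are represented by their canonical residues in {0,…,q-1} ⊆ ℕ.

IsOrd : (q u k : ℕ) → .{{_ : NonZero q}} → Set
IsOrd q u k = (0 < k) × ((u ^ k) % q ≡ 1 % q)
            × (∀ j → 0 < j → j < k → (u ^ j) % q ≢ 1 % q)

-- The symmetric group S_3, as the explicit list of its six elements
-- (each given as a function Fin 3 → Fin 3; indices 0,1,2 stand for 1,2,3).
i₀ i₁ i₂ : Fin 3
i₀ = zero
i₁ = suc zero
i₂ = suc (suc zero)

perm : Fin 3 → Fin 3 → Fin 3 → (Fin 3 → Fin 3)
perm x y z zero = x
perm x y z (suc zero) = y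
perm x y z (suc (suc zero)) = z

S₃ : List (Fin 3 → Fin 3)
S₃ = perm i₀ i₁ i₂ ∷ perm i₀ i₂ i₁ ∷ perm i₁ i₀ i₂ ∷ perm i₁ i₂ i₀ ∷ perm i₂ i₀ i₁ ∷ perm i₂ i₁ i₀ ∷ []

elemA : (q u : ℕ) → .{{_ : NonZero q}} → (Fin 3 → ℕ) → (Fin 3 → Fin 3) → ℕ
elemA q u a σ = (a (σ i₀) + u * a (σ i₁) + u ^ 2 * a (σ i₂)) % q

Alist : (q u : ℕ) → .{{_ : NonZero q}} → (Fin 3 → ℕ) → List ℕ
Alist q u a = map (elemA q u a) S₃

cardA : (q u : ℕ) → .{{_ : NonZero q}} → (Fin 3 → ℕ) → ℕ
cardA q u a = length (deduplicate _≟_ (Alist q u a))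

-- The six elements of A are the values E(x,y,z) = x + u y + u² z over the orderings (x,y,z) of
-- a₁, a₂, a₃. Orderings differing by a transposition give values differing by (y − x)(u − 1),
-- u(z − y)(u − 1) or (z − x)(u² − 1), so once ord_q(u) > 2 no even ordering shares its value with
-- an odd one. Within a parity class, E(x,y,z) − u E(y,z,x) = x(1 − u³). If the three rotations
-- of (x,y,z) had equal values, (y − x)(u³ − 1) ≡ 0 (mod q), impossible when ord_q(u) > 3; so each class
-- has two values, giving |A| ≥ 4. If u³ ≡ 1, then E(x,y,z) − E(y,z,x) ≡ (u − 1) E(y,z,x), so two
-- rotations have equal values only when one of them is 0.
module Submission where

open import Defs
open import Data.Nat using (ℕ; _<_; _≤_; NonZero; _%_)
open import Data.Nat.Divisibility using (_∣_)
open import Data.Nat.Primality using (Prime)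
open import Data.Fin using (Fin)
open import Data.Product using (_×_; ∃)
open import Data.Sum using (_⊎_)
open import Data.List.Membership.Propositional using (_∈_)
open import Relation.Nullary using (¬_)
open import Relation.Binary.PropositionalEquality using (_≡_; _≢_)

open import Data.Nat as ℕ using (zero; suc; _/_; _∸_; z≤n; s≤s)
import Data.Nat.Properties as ℕ
open import Data.Nat.DivMod using (%-remove-+ʳ; m<n⇒m%n≡m)
open import Data.Nat.Divisibility using (n∣m⇒m%n≡0)
open import Data.Nat.Primality using (euclidsLemma)
open import Data.Integer as ℤ using (ℤ; +_; _+_; _*_; _-_; _^_; 1ℤ; ∣_∣)
import Data.Integer.Properties as ℤ
open import Data.Integer.DivMod using (a≡a%ℕn+[a/ℕn]*n)
open import Data.Integer.Divisibility.Signed using (divides; ∣⇒∣ᵤ; ∣ᵤ⇒∣; ∣n⇒∣m*n; ∣m∣n⇒∣m+n; ∣m∣n⇒∣m-n)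
  renaming (_∣_ to _∣ℤ_)
open import Data.Integer.Tactic.RingSolver using (solve-∀)
open import Data.Fin using (zero; suc)
open import Data.List using (List; []; _∷_; length; deduplicate; filter)
open import Data.List.Properties using (filter-notAll; length-deduplicate)
open import Data.List.Relation.Unary.All as All using (All; []; _∷_)
open import Data.List.Relation.Unary.AllPairs using ([]; _∷_)
open import Data.List.Relation.Unary.Any as Any using (here; there)
open import Data.List.Relation.Unary.Unique.Propositional using (Unique)
open import Data.List.Relation.Binary.Subset.Propositional using (_⊆_)
open import Data.List.Membership.Propositional.Properties using (∈-filter⁺; ∈-deduplicate⁺)
open import Data.List.Membership.DecPropositional ℕ._≟_ using (_∈?_)
open import Data.Product using (_,_; ∃₂)
open import Data.Sum as Sum using (inj₁; inj₂; [_,_])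
open import Data.Empty using (⊥-elim)
open import Function using (_∘_; id)
open import Relation.Nullary using (Dec; yes; no; ¬?)
open import Relation.Binary.Definitions using (DecidableEquality)
open import Relation.Binary.PropositionalEquality using (refl; sym; trans; cong; cong₂; subst; ≢-sym; module ≡-Reasoning)

module _ {A : Set} (_≟_ : DecidableEquality A) where

  unique⊆⇒length≤ : {xs ys : List A} → Unique ys → ys ⊆ xs → length ys ≤ length xs
  unique⊆⇒length≤ {ys = []} _ _ = z≤n
  unique⊆⇒length≤ {xs} {y ∷ ys} (y∉ys ∷ ys!) y∷ys⊆xs =
    ℕ.≤-trans (s≤s (unique⊆⇒length≤ ys! ys⊆xs∖y))
              (filter-notAll ≢y? xs (Any.map (λ y≡x x≢y → x≢y (sym y≡x)) (y∷ys⊆xs (here refl))))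
    where
    ≢y? : (x : A) → Dec (x ≢ y)
    ≢y? x = ¬? (x ≟ y)
    ys⊆xs∖y : ys ⊆ filter ≢y? xs
    ys⊆xs∖y z∈ys = ∈-filter⁺ ≢y? (y∷ys⊆xs (there z∈ys)) (≢-sym (All.lookup y∉ys z∈ys))

  unique⊆⇒length≤deduplicate : {xs ys : List A} → Unique ys → ys ⊆ xs → length ys ≤ length (deduplicate _≟_ xs)
  unique⊆⇒length≤deduplicate ys! ys⊆xs = unique⊆⇒length≤ ys! (∈-deduplicate⁺ _≟_ ∘ ys⊆xs)

  distinct-pair : (a b c : A) → ¬ (a ≡ b × b ≡ c) → ∃₂ λ m n → m ≢ n × m ∈ a ∷ b ∷ c ∷ [] × n ∈ a ∷ b ∷ c ∷ []
  distinct-pair a b c not-constant with a ≟ b | b ≟ c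
  ... | no a≢b | _      = a , b , a≢b , here refl , there (here refl)
  ... | yes _  | no b≢c = b , c , b≢c , there (here refl) , there (there (here refl))
  ... | yes a≡b | yes b≡c = ⊥-elim (not-constant (a≡b , b≡c))

-- x + u * y + u * u * z is the value of x + yT + zT² at T = u (the ring solver does not handle ℤ's _^_).
swap₀₁-difference : ∀ u x y z → (x + u * y + u * u * z) - (y + u * x + u * u * z) ≡ (y - x) * (u - 1ℤ)
swap₀₁-difference = solve-∀

swap₁₂-difference : ∀ u x y z → (x + u * y + u * u * z) - (x + u * z + u * u * y) ≡ u * ((z - y) * (u - 1ℤ))
swap₁₂-difference = solve-∀

swap₀₂-difference : ∀ u x y z → (x + u * y + u * u * z) - (z + u * y + u * u * x) ≡ (z - x) * (u * u - 1ℤ)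
swap₀₂-difference = solve-∀

rotation-differences : ∀ u x y z →
  ((x + u * y + u * u * z) - (y + u * z + u * u * x)) - u * ((y + u * z + u * u * x) - (z + u * x + u * u * y))
    ≡ (y - x) * (u * u * u - 1ℤ)
rotation-differences = solve-∀

rotation-difference : ∀ u x y z →
  (u - 1ℤ) * (y + u * z + u * u * x) ≡ ((x + u * y + u * u * z) - (y + u * z + u * u * x)) + x * (u * u * u - 1ℤ)
rotation-difference = solve-∀

module _ {p : ℕ} (p-prime : Prime p) where

  prime∣*⇒∣⊎∣ : ∀ m n → + p ∣ℤ m * n → + p ∣ℤ m ⊎ + p ∣ℤ n
  prime∣*⇒∣⊎∣ m n p∣mn =
    Sum.map ∣ᵤ⇒∣ ∣ᵤ⇒∣ (euclidsLemma ∣ m ∣ ∣ n ∣ p-prime (subst (p ∣_) (ℤ.abs-* m n) (∣⇒∣ᵤ p∣mn)))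

  prime∤*∤ : ∀ {m n} → ¬ + p ∣ℤ m → ¬ + p ∣ℤ n → ¬ + p ∣ℤ m * n
  prime∤*∤ {m} {n} p∤m p∤n = [ p∤m , p∤n ] ∘ prime∣*⇒∣⊎∣ m n

  prime∣*∤⇒∣ : ∀ {m n} → + p ∣ℤ m * n → ¬ + p ∣ℤ m → + p ∣ℤ n
  prime∣*∤⇒∣ {m} {n} p∣mn p∤m = [ ⊥-elim ∘ p∤m , id ] (prime∣*⇒∣⊎∣ m n p∣mn)

  ≡*-prime∤ : ∀ {l m n} → l ≡ m * n → ¬ + p ∣ℤ m → ¬ + p ∣ℤ n → ¬ + p ∣ℤ l
  ≡*-prime∤ l≡mn p∤m p∤n = prime∤*∤ p∤m p∤n ∘ subst (+ p ∣ℤ_) l≡mn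

module _ {q : ℕ} .{{_ : NonZero q}} where

  %≡%⇒∣- : ∀ {m n v w} → + m ≡ v → + n ≡ w → m % q ≡ n % q → + q ∣ℤ v - w
  %≡%⇒∣- {m} {n} refl refl m%q≡n%q = divides (+ (m / q) - + (n / q)) (begin
    + m - + n                                                      ≡⟨ cong₂ _-_ (euclid m) (euclid n) ⟩
    (+ (m % q) + + (m / q) * + q) - (+ (n % q) + + (n / q) * + q)  ≡⟨ cong (λ r → (+ r + + (m / q) * + q) - _) m%q≡n%q ⟩
    (+ (n % q) + + (m / q) * + q) - (+ (n % q) + + (n / q) * + q)  ≡⟨ cancel (+ (n % q)) (+ (m / q)) (+ (n / q)) (+ q) ⟩
    (+ (m / q) - + (n / q)) * + q                                  ∎)
    where
    open ≡-Reasoning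
    euclid : ∀ m → + m ≡ + (m % q) + + (m / q) * + q
    euclid m = a≡a%ℕn+[a/ℕn]*n (+ m) q
    cancel : ∀ r a b d → (r + a * d) - (r + b * d) ≡ (a - b) * d
    cancel = solve-∀

  ∣∸⇒%≡% : ∀ {m n} → n ≤ m → q ∣ m ∸ n → m % q ≡ n % q
  ∣∸⇒%≡% {m} {n} n≤m q∣m∸n = begin
    m % q               ≡⟨ cong (_% q) (ℕ.m+[n∸m]≡n n≤m) ⟨
    (n ℕ.+ (m ∸ n)) % q ≡⟨ %-remove-+ʳ n q∣m∸n ⟩
    n % q               ∎
    where open ≡-Reasoning

  ∣-⇒%≡% : ∀ {m n v w} → + m ≡ v → + n ≡ w → + q ∣ℤ v - w → m % q ≡ n % q
  ∣-⇒%≡% {m} {n} refl refl q∣m-n with q∣∣m⊖n∣ ← subst (λ d → q ∣ ∣ d ∣) (ℤ.m-n≡m⊖n m n) (∣⇒∣ᵤ q∣m-n) | ℕ.≤-total n m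
  ... | inj₁ n≤m = ∣∸⇒%≡% n≤m (subst (q ∣_) (trans (ℤ.∣m⊖n∣≡∣n⊖m∣ m n) (ℤ.∣⊖∣-≤ n≤m)) q∣∣m⊖n∣)
  ... | inj₂ m≤n = sym (∣∸⇒%≡% m≤n (subst (q ∣_) (ℤ.∣⊖∣-≤ m≤n) q∣∣m⊖n∣))

pos-^ : ∀ m n → + (m ℕ.^ n) ≡ (+ m) ^ n
pos-^ m zero = refl
pos-^ m (suc n) = trans (ℤ.pos-* m (m ℕ.^ n)) (cong ((+ m) *_) (pos-^ m n))

pos-^-one : ∀ m → + (m ℕ.^ 1) ≡ + m
pos-^-one m = cong +_ (ℕ.*-identityʳ m)

^-square : ∀ v → v ^ 2 ≡ v * v
^-square v = cong (v *_) (ℤ.*-identityʳ v)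

pos-^-square : ∀ m → + (m ℕ.^ 2) ≡ + m * + m
pos-^-square m = trans (pos-^ m 2) (^-square (+ m))

pos-^-cube : ∀ m → + (m ℕ.^ 3) ≡ + m * + m * + m
pos-^-cube m = trans (pos-^ m 3) (trans (cong ((+ m) *_) (^-square (+ m))) (sym (ℤ.*-assoc (+ m) (+ m) (+ m))))

module Residues
  (q : ℕ) .{{_ : NonZero q}} (q-prime : Prime q)
  (a : Fin 3 → ℕ) (a<q : ∀ i → a i < q) (a-injective : ∀ i j → a i ≡ a j → i ≡ j)
  (u : ℕ) (q∤u : ¬ + q ∣ℤ + u) (q∤u-1 : ¬ + q ∣ℤ + u - 1ℤ) (q∤u²-1 : ¬ + q ∣ℤ + u * + u - 1ℤ)
  where

  x : Fin 3 → ℤ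
  x i = + a i

  U : ℤ
  U = + u

  res : Fin 3 → Fin 3 → Fin 3 → ℕ
  res i j k = elemA q u a (perm i j k)

  val : Fin 3 → Fin 3 → Fin 3 → ℤ
  val i j k = x i + U * x j + U * U * x k

  val-cast : ∀ i j k → + (a i ℕ.+ u ℕ.* a j ℕ.+ u ℕ.^ 2 ℕ.* a k) ≡ val i j k
  val-cast i j k = begin
    + (a i ℕ.+ u ℕ.* a j ℕ.+ u ℕ.^ 2 ℕ.* a k)    ≡⟨ ℤ.pos-+ (a i ℕ.+ u ℕ.* a j) _ ⟩
    + (a i ℕ.+ u ℕ.* a j) + + (u ℕ.^ 2 ℕ.* a k) ≡⟨ cong₂ _+_ (ℤ.pos-+ (a i) _) (ℤ.pos-* (u ℕ.^ 2) (a k)) ⟩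
    x i + + (u ℕ.* a j) + + (u ℕ.^ 2) * x k     ≡⟨ cong₂ (λ s t → x i + s + t * x k) (ℤ.pos-* u (a j)) (pos-^-square u) ⟩
    val i j k                                   ∎
    where open ≡-Reasoning

  res≡⇒∣ : ∀ i j k i′ j′ k′ → res i j k ≡ res i′ j′ k′ → + q ∣ℤ val i j k - val i′ j′ k′
  res≡⇒∣ i j k i′ j′ k′ = %≡%⇒∣- (val-cast i j k) (val-cast i′ j′ k′)

  ∤⇒res≢ : ∀ i j k i′ j′ k′ → ¬ + q ∣ℤ val i j k - val i′ j′ k′ → res i j k ≢ res i′ j′ k′
  ∤⇒res≢ i j k i′ j′ k′ q∤ = q∤ ∘ res≡⇒∣ i j k i′ j′ k′

  ∣⇒res≡0 : ∀ i j k → + q ∣ℤ val i j k → res i j k ≡ 0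
  ∣⇒res≡0 i j k q∣ = n∣m⇒m%n≡0 _ q (∣⇒∣ᵤ (subst (+ q ∣ℤ_) (sym (val-cast i j k)) q∣))

  x-apart : ∀ i j → i ≢ j → ¬ + q ∣ℤ x i - x j
  x-apart i j i≢j q∣ = i≢j (a-injective i j (begin
    a i     ≡⟨ m<n⇒m%n≡m (a<q i) ⟨
    a i % q ≡⟨ ∣-⇒%≡% refl refl q∣ ⟩
    a j % q ≡⟨ m<n⇒m%n≡m (a<q j) ⟩
    a j     ∎))
    where open ≡-Reasoning

  transpose₀₁ : ∀ i j k → i ≢ j → res i j k ≢ res j i k
  transpose₀₁ i j k i≢j = ∤⇒res≢ i j k j i k
    (≡*-prime∤ q-prime (swap₀₁-difference U (x i) (x j) (x k)) (x-apart j i (≢-sym i≢j)) q∤u-1)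

  transpose₁₂ : ∀ i j k → j ≢ k → res i j k ≢ res i k j
  transpose₁₂ i j k j≢k = ∤⇒res≢ i j k i k j
    (≡*-prime∤ q-prime (swap₁₂-difference U (x i) (x j) (x k)) q∤u (prime∤*∤ q-prime (x-apart k j (≢-sym j≢k)) q∤u-1))

  transpose₀₂ : ∀ i j k → i ≢ k → res i j k ≢ res k j i
  transpose₀₂ i j k i≢k = ∤⇒res≢ i j k k j i
    (≡*-prime∤ q-prime (swap₀₂-difference U (x i) (x j) (x k)) (x-apart k i (≢-sym i≢k)) q∤u²-1)

  rotations-not-all-equal : ¬ + q ∣ℤ U * U * U - 1ℤ →
    ∀ i j k → i ≢ j → ¬ (res i j k ≡ res j k i × res j k i ≡ res k i j)
  rotations-not-all-equal q∤u³-1 i j k i≢j (r≡r′ , r′≡r″) =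
    q∤u³-1 (prime∣*∤⇒∣ q-prime q∣product (x-apart j i (≢-sym i≢j)))
    where
    q∣product : + q ∣ℤ (x j - x i) * (U * U * U - 1ℤ)
    q∣product = subst (+ q ∣ℤ_) (rotation-differences U (x i) (x j) (x k))
      (∣m∣n⇒∣m-n (res≡⇒∣ i j k j k i r≡r′) (∣n⇒∣m*n U (res≡⇒∣ j k i k i j r′≡r″)))

  rotation-≢ : + q ∣ℤ U * U * U - 1ℤ → ∀ i j k → res j k i ≢ 0 → res i j k ≢ res j k i
  rotation-≢ q∣u³-1 i j k r′≢0 r≡r′ = r′≢0 (∣⇒res≡0 j k i (prime∣*∤⇒∣ q-prime q∣product q∤u-1))
    where
    q∣product : + q ∣ℤ (U - 1ℤ) * val j k i
    q∣product = subst (+ q ∣ℤ_) (sym (rotation-difference U (x i) (x j) (x k)))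
      (∣m∣n⇒∣m+n (res≡⇒∣ i j k j k i r≡r′) (∣n⇒∣m*n (x i) q∣u³-1))

  -- Alist q u a is res at the orderings 012, 021, 102, 120, 201, 210, in this order.
  evens odds : List ℕ
  evens = res i₀ i₁ i₂ ∷ res i₁ i₂ i₀ ∷ res i₂ i₀ i₁ ∷ []
  odds  = res i₀ i₂ i₁ ∷ res i₂ i₁ i₀ ∷ res i₁ i₀ i₂ ∷ []

  evens⊆A : evens ⊆ Alist q u a
  evens⊆A (here refl)                 = here refl
  evens⊆A (there (here refl))         = there (there (there (here refl)))
  evens⊆A (there (there (here refl))) = there (there (there (there (here refl))))

  odds⊆A : odds ⊆ Alist q u a
  odds⊆A (here refl)                 = there (here refl)
  odds⊆A (there (here refl))         = there (there (there (there (there (here refl)))))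
  odds⊆A (there (there (here refl))) = there (there (here refl))

  even≢odd : ∀ {m n} → m ∈ evens → n ∈ odds → m ≢ n
  even≢odd (here refl)                 (here refl)                 = transpose₁₂ i₀ i₁ i₂ (λ ())
  even≢odd (here refl)                 (there (here refl))         = transpose₀₂ i₀ i₁ i₂ (λ ())
  even≢odd (here refl)                 (there (there (here refl))) = transpose₀₁ i₀ i₁ i₂ (λ ())
  even≢odd (there (here refl))         (here refl)                 = transpose₀₂ i₁ i₂ i₀ (λ ())
  even≢odd (there (here refl))         (there (here refl))         = transpose₀₁ i₁ i₂ i₀ (λ ())
  even≢odd (there (here refl))         (there (there (here refl))) = transpose₁₂ i₁ i₂ i₀ (λ ())
  even≢odd (there (there (here refl))) (here refl)                 = transpose₀₁ i₂ i₀ i₁ (λ ())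
  even≢odd (there (there (here refl))) (there (here refl))         = transpose₁₂ i₂ i₀ i₁ (λ ())
  even≢odd (there (there (here refl))) (there (there (here refl))) = transpose₀₂ i₂ i₀ i₁ (λ ())

  4≤cardA : ¬ + q ∣ℤ U * U * U - 1ℤ → 4 ≤ cardA q u a
  4≤cardA q∤u³-1
    with e , e′ , e≢e′ , e∈ , e′∈ ← distinct-pair ℕ._≟_ _ _ _ (rotations-not-all-equal q∤u³-1 i₀ i₁ i₂ (λ ()))
       | o , o′ , o≢o′ , o∈ , o′∈ ← distinct-pair ℕ._≟_ _ _ _ (rotations-not-all-equal q∤u³-1 i₀ i₂ i₁ (λ ()))
    = unique⊆⇒length≤deduplicate ℕ._≟_
        ((e≢e′ ∷ even≢odd e∈ o∈ ∷ even≢odd e∈ o′∈ ∷ []) ∷ (even≢odd e′∈ o∈ ∷ even≢odd e′∈ o′∈ ∷ []) ∷ (o≢o′ ∷ []) ∷ [] ∷ [])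
        (All.lookup (evens⊆A e∈ ∷ evens⊆A e′∈ ∷ odds⊆A o∈ ∷ odds⊆A o′∈ ∷ []))

  cardA≡6 : + q ∣ℤ U * U * U - 1ℤ → ¬ 0 ∈ Alist q u a → cardA q u a ≡ 6
  cardA≡6 q∣u³-1 0∉A =
    ℕ.≤-antisym (length-deduplicate ℕ._≟_ (Alist q u a)) (unique⊆⇒length≤deduplicate ℕ._≟_ A-unique id)
    where
    rotation : ∀ i j k → res j k i ∈ Alist q u a → res i j k ≢ res j k i
    rotation i j k r′∈A = rotation-≢ q∣u³-1 i j k λ r′≡0 → 0∉A (subst (_∈ Alist q u a) r′≡0 r′∈A)

    A-unique : Unique (Alist q u a)
    A-unique =
        (transpose₁₂ i₀ i₁ i₂ (λ ()) ∷ transpose₀₁ i₀ i₁ i₂ (λ ())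
          ∷ rotation i₀ i₁ i₂ (there (there (there (here refl))))
          ∷ ≢-sym (rotation i₂ i₀ i₁ (here refl)) ∷ transpose₀₂ i₀ i₁ i₂ (λ ()) ∷ [])
      ∷ (≢-sym (rotation i₁ i₀ i₂ (there (here refl))) ∷ transpose₀₂ i₀ i₂ i₁ (λ ()) ∷ transpose₀₁ i₀ i₂ i₁ (λ ())
          ∷ rotation i₀ i₂ i₁ (there (there (there (there (there (here refl)))))) ∷ [])
      ∷ (transpose₁₂ i₁ i₀ i₂ (λ ()) ∷ transpose₀₂ i₁ i₀ i₂ (λ ())
          ∷ ≢-sym (rotation i₂ i₁ i₀ (there (there (here refl)))) ∷ [])
      ∷ (rotation i₁ i₂ i₀ (there (there (there (there (here refl))))) ∷ transpose₀₁ i₁ i₂ i₀ (λ ()) ∷ [])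
      ∷ (transpose₁₂ i₂ i₀ i₁ (λ ()) ∷ [])
      ∷ [] ∷ []

lemma3p6 : (q : ℕ) → .{{_ : NonZero q}} → Prime q
    → (a : Fin 3 → ℕ) → (∀ i → a i < q) → (∀ i j → a i ≡ a j → i ≡ j)
    → (u : ℕ) → 0 < u → ¬ (q ∣ u)
    → ((∃ λ k → IsOrd q u k × 3 < k) → 4 ≤ cardA q u a)
    × ((IsOrd q u 3) → (0 ∈ Alist q u a) ⊎ (cardA q u a ≡ 6))
lemma3p6 q q-prime a a<q a-injective u _ q∤u = order>3⇒4≤cardA , order≡3⇒0∈A⊎cardA≡6
  where
  module Order>2 {k} (minimal : ∀ j → 0 < j → j < k → (u ℕ.^ j) % q ≢ 1 % q) (2<k : 2 < k) =
    Residues q q-prime a a<q a-injective u (q∤u ∘ ∣⇒∣ᵤ)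
      (minimal 1 (s≤s z≤n) (ℕ.<-trans (ℕ.n<1+n 1) 2<k) ∘ ∣-⇒%≡% (pos-^-one u) refl)
      (minimal 2 (s≤s z≤n) 2<k ∘ ∣-⇒%≡% (pos-^-square u) refl)

  order>3⇒4≤cardA : (∃ λ k → IsOrd q u k × 3 < k) → 4 ≤ cardA q u a
  order>3⇒4≤cardA (k , (_ , _ , minimal) , 3<k) =
    4≤cardA (minimal 3 (s≤s z≤n) 3<k ∘ ∣-⇒%≡% (pos-^-cube u) refl)
    where open Order>2 minimal (ℕ.<-trans (ℕ.n<1+n 2) 3<k)

  order≡3⇒0∈A⊎cardA≡6 : IsOrd q u 3 → (0 ∈ Alist q u a) ⊎ (cardA q u a ≡ 6)
  order≡3⇒0∈A⊎cardA≡6 (_ , u³≡1 , minimal) with 0 ∈? Alist q u a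
  ... | yes 0∈A = inj₁ 0∈A
  ... | no 0∉A  = inj₂ (cardA≡6 (%≡%⇒∣- (pos-^-cube u) refl u³≡1) 0∉A)
    where open Order>2 minimal (ℕ.n<1+n 2)
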